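{- Let $k_1=1$ and $k_n = \lfloor n/2\rfloor + k_{\lfloor n/2\rfloor} + k_{\lfloor (n+1)/2\rfloor}$ for $n\ge2$. Then for every $n\in\mathbb{N}$, $H(n) \geq k_n$, and consequently $$H(n) > \tfrac{1}{2}n\log_2 n - \tfrac{1}{2}n + \tfrac{1}{2}.$$
   Context: A hypergraph is a set $V$ with a family $\mathcal{H}$ of subsets of $V$; a vertex is isolated if it lies in no hyperedge. $(V,\mathcal{H})$ contains a partition of size $m$ if there are $D\subseteq V$, $\mathcal{P}\subseteq\mathcal{H}$ with $|D|=m$ and every member of $D$ in exactly one member of $\mathcal{P}$. $H(n)$ is the greatest $k$ such that there is a hypergraph with $|V|=k$, no isolated vertices, and no partition of size greater than $n$. -}

module Defs where

open import Data.Nat using (ℕ; zero; suc; _+_; _≤_; _/_)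
open import Data.Fin using (Fin)
open import Data.Fin.Subset using (Subset; _∈_; ∣_∣)
open import Data.Fin.Subset.Properties using (_∈?_)
open import Data.List using (length; filter; allFin)
open import Data.Product using (Σ)
open import Relation.Nullary.Decidable using (_×-dec_)
open import Relation.Binary.PropositionalEquality using (_≡_)

record Hypergraph (v : ℕ) : Set where
  field
    e     : ℕ
    edge  : Fin e → Subset v

open Hypergraph public

NoIsolated : ∀ {v} → Hypergraph v → Set
NoIsolated {v} G = (x : Fin v) → Σ (Fin (e G)) (λ j → x ∈ edge G j)

countContaining : ∀ {v} (G : Hypergraph v) → Subset (e G) → Fin v → ℕ
countContaining G P x =
  length (filter (λ j → (j ∈? P) ×-dec (x ∈? edge G j)) (allFin (e G)))

IsPartition : ∀ {v} (G : Hypergraph v) → Subset v → Subset (e G) → Set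
IsPartition G D P = ∀ x → x ∈ D → countContaining G P x ≡ 1

NoPartitionAbove : ∀ {v} → Hypergraph v → ℕ → Set
NoPartitionAbove G n = ∀ D P → IsPartition G D P → ∣ D ∣ ≤ n

-- "H(n) ≥ k": some hypergraph with at least k vertices, no isolated
-- vertices and no partition of size greater than n
-- (since H(n) is the greatest such vertex count).
HAtLeast : ℕ → ℕ → Set
HAtLeast n k = Σ ℕ (λ v → k ≤ v × Σ (Hypergraph v) (λ G → NoIsolated G × NoPartitionAbove G n))
  where open import Data.Product using (_×_)

-- k_1 = 1, k_n = ⌊n/2⌋ + k_{⌊n/2⌋} + k_{⌊(n+1)/2⌋} for n ≥ 2.
-- Computed with fuel; fuel ≥ n suffices since both recursive arguments are < n.
kFuel : ℕ → ℕ → ℕ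
kFuel zero n = 1
kFuel (suc f) zero = 1
kFuel (suc f) (suc zero) = 1
kFuel (suc f) (suc (suc m)) =
  let n = suc (suc m) in (n / 2) + kFuel f (n / 2) + kFuel f (suc n / 2)

kSeq : ℕ → ℕ
kSeq n = kFuel n n

-- Glueing: from hypergraphs GA, GB on at least k_a, k_b vertices without partitions larger
-- than a resp. b (a ≤ b ≤ a + 1), take their disjoint union and add a new vertices to every
-- hyperedge.  A partition avoiding the new vertices splits into partitions of GA and GB, so it
-- has size at most a + b; a partition containing a new vertex uses exactly one hyperedge, so it
-- lies inside GA or inside GB and has size at most a + max(a, b) = a + b.  Hence
-- H(a + b) ≥ a + k_a + k_b, which is the recursion for k_n with a = ⌊n/2⌋, b = ⌈n/2⌉.
-- The logarithmic bound is the invariant 2(n+1)^n ≤ 2^(2k_n + n), which survives the same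
-- recursion because 1 + a + b ≤ 2(1 + a).

module Submission where

open import Defs
open import Data.Bool using (true; false; _∧_)
open import Data.Fin using (Fin; _↑ˡ_; _↑ʳ_; fromℕ<)
import Data.Fin as Fin
open import Data.Fin.Subset using (Subset; _∈_; ∣_∣; _∩_; ⊤; ⊥; inside; outside; Empty)
open import Data.Fin.Subset.Properties
  using (_∈?_; ∈⊤; ∣p∣≤n; ∣⊥∣≡0; ∣p∩q∣≤∣p∣; ∩-identityʳ; ∩-zeroʳ; nonempty?; Empty-unique)
import Data.List as List
open import Data.Nat using (ℕ; zero; suc; _+_; _⊔_; _*_; _∸_; _^_; _<_; _≤_; z≤n; s≤s; s≤s⁻¹; _/_; ⌊_/2⌋; ⌈_/2⌉)
open import Data.Nat.DivMod using (m/n≡1+[m∸n]/n)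
open import Data.Nat.Induction using (<-rec)
open import Data.Nat.Properties
open import Data.Nat.Tactic.RingSolver using (solve-∀)
open import Data.Product using (_×_; Σ; _,_; proj₁; proj₂)
open import Data.Sum using (_⊎_; inj₁; inj₂)
open import Data.Vec using (_∷_; []; _++_; lookup; tabulate; replicate; here)
import Data.Vec as Vec
open import Data.Vec.Properties
  using (lookup∘tabulate; tabulate∘lookup; tabulate-cong; lookup-zipWith; zipWith-++;
         lookup-++ˡ; lookup-++ʳ; lookup-replicate; []=⇒lookup; lookup⇒[]=)
open import Data.Vec.Functional using () renaming (_++_ to _++ᶠ_)
import Data.Vec.Functional.Properties as Vecᶠ
open import Function using (id; _∘_; flip)
open import Relation.Binary.PropositionalEquality
open import Relation.Nullary using (does; yes; no; _×-dec_)
open import Relation.Unary using (Pred; Decidable)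

private
  variable
    m n : ℕ

∣p++q∣≡∣p∣+∣q∣ : (p : Subset m) (q : Subset n) → ∣ p ++ q ∣ ≡ ∣ p ∣ + ∣ q ∣
∣p++q∣≡∣p∣+∣q∣ []            q = refl
∣p++q∣≡∣p∣+∣q∣ (inside  ∷ p) q = cong suc (∣p++q∣≡∣p∣+∣q∣ p q)
∣p++q∣≡∣p∣+∣q∣ (outside ∷ p) q = ∣p++q∣≡∣p∣+∣q∣ p q

Empty⇒∣p∣≡0 : {p : Subset n} → Empty p → ∣ p ∣ ≡ 0
Empty⇒∣p∣≡0 {n} p-empty = trans (cong ∣_∣ (Empty-unique p-empty)) (∣⊥∣≡0 n)

m+n≡1⇒m≡0⊎n≡0 : ∀ m n → m + n ≡ 1 → m ≡ 0 ⊎ n ≡ 0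
m+n≡1⇒m≡0⊎n≡0 zero          n       _  = inj₁ refl
m+n≡1⇒m≡0⊎n≡0 (suc m)       zero    _  = inj₂ refl
m+n≡1⇒m≡0⊎n≡0 (suc zero)    (suc n) ()
m+n≡1⇒m≡0⊎n≡0 (suc (suc m)) (suc n) ()

∈-++⁺ˡ : {x : Fin m} {p : Subset m} (q : Subset n) → x ∈ p → x ↑ˡ n ∈ p ++ q
∈-++⁺ˡ {x = x} {p} q x∈p = lookup⇒[]= _ (p ++ q) (trans (lookup-++ˡ p q x) ([]=⇒lookup x∈p))

∈-++⁺ʳ : {x : Fin n} (p : Subset m) {q : Subset n} → x ∈ q → m ↑ʳ x ∈ p ++ q
∈-++⁺ʳ {x = x} p {q} x∈q = lookup⇒[]= _ (p ++ q) (trans (lookup-++ʳ p q x) ([]=⇒lookup x∈q))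

tabulate-++ : ∀ {a} {A : Set a} m (f : Fin (m + n) → A) → tabulate f ≡ tabulate (f ∘ (_↑ˡ n)) ++ tabulate (f ∘ (m ↑ʳ_))
tabulate-++ zero    f = refl
tabulate-++ (suc m) f = cong (f Fin.zero ∷_) (tabulate-++ m (f ∘ Fin.suc))

tabulate≡replicate : ∀ {a} {A : Set a} {f : Fin n → A} {x : A} → (∀ i → f i ≡ x) → tabulate f ≡ replicate n x
tabulate≡replicate {zero}  f≡x = refl
tabulate≡replicate {suc n} f≡x = cong₂ _∷_ (f≡x Fin.zero) (tabulate≡replicate (f≡x ∘ Fin.suc))

↑ˡ-↑ʳ-elim : (P : Fin (m + n) → Set) → (∀ i → P (i ↑ˡ n)) → (∀ j → P (m ↑ʳ j)) → ∀ x → P x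
↑ˡ-↑ʳ-elim {zero}  P left right x           = right x
↑ˡ-↑ʳ-elim {suc m} P left right Fin.zero    = left Fin.zero
↑ˡ-↑ʳ-elim {suc m} P left right (Fin.suc x) = ↑ˡ-↑ʳ-elim (P ∘ Fin.suc) (left ∘ Fin.suc) right x

length-filter-tabulate : ∀ {a p} {A : Set a} {P : Pred A p} (P? : Decidable P) (f : Fin n → A) →
  List.length (List.filter P? (List.tabulate f)) ≡ ∣ tabulate (does ∘ P? ∘ f) ∣
length-filter-tabulate {zero}  P? f = refl
length-filter-tabulate {suc n} P? f with does (P? (f Fin.zero))
... | true  = cong suc (length-filter-tabulate P? (f ∘ Fin.suc))
... | false = length-filter-tabulate P? (f ∘ Fin.suc)

does-∈? : (x : Fin n) (p : Subset n) → does (x ∈? p) ≡ lookup p x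
does-∈? Fin.zero    (inside  ∷ p) = refl
does-∈? Fin.zero    (outside ∷ p) = refl
does-∈? (Fin.suc x) (s ∷ p)       = does-∈? x p

tabulate[p∧q]≡p∩q : (p q : Subset n) → tabulate (λ j → lookup p j ∧ lookup q j) ≡ p ∩ q
tabulate[p∧q]≡p∩q p q = trans (tabulate-cong (λ j → sym (lookup-zipWith _∧_ j p q))) (tabulate∘lookup (p ∩ q))

∣p∩⊥∣≡0 : (p : Subset n) → ∣ p ∩ ⊥ ∣ ≡ 0
∣p∩⊥∣≡0 {n} p = trans (cong ∣_∣ (∩-zeroʳ p)) (∣⊥∣≡0 n)

∣p++q∩r++s∣≡∣p∩r∣+∣q∩s∣ : (p r : Subset m) (q s : Subset n) → ∣ (p ++ q) ∩ (r ++ s) ∣ ≡ ∣ p ∩ r ∣ + ∣ q ∩ s ∣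
∣p++q∩r++s∣≡∣p∩r∣+∣q∩s∣ p r q s = trans (cong ∣_∣ (zipWith-++ _∧_ p q r s)) (∣p++q∣≡∣p∣+∣q∣ (p ∩ r) (q ∩ s))

incident : ∀ {v} (G : Hypergraph v) → Fin v → Subset (e G)
incident G x = tabulate (λ j → lookup (edge G j) x)

countContaining≡∣P∩incident∣ : ∀ {v} (G : Hypergraph v) P x → countContaining G P x ≡ ∣ P ∩ incident G x ∣
countContaining≡∣P∩incident∣ G P x = begin
  countContaining G P x
    ≡⟨ length-filter-tabulate (λ j → (j ∈? P) ×-dec (x ∈? edge G j)) id ⟩
  ∣ tabulate (λ j → does (j ∈? P) ∧ does (x ∈? edge G j)) ∣
    ≡⟨ cong ∣_∣ (tabulate-cong λ j → cong₂ _∧_ (does-∈? j P)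
                   (trans (does-∈? x (edge G j)) (sym (lookup∘tabulate _ j)))) ⟩
  ∣ tabulate (λ j → lookup P j ∧ lookup (incident G x) j) ∣
    ≡⟨ cong ∣_∣ (tabulate[p∧q]≡p∩q P (incident G x)) ⟩
  ∣ P ∩ incident G x ∣ ∎
  where open ≡-Reasoning

countContaining-via-incident : ∀ {v} (G : Hypergraph v) P {x I} → incident G x ≡ I → countContaining G P x ≡ ∣ P ∩ I ∣
countContaining-via-incident G P {x} eq = trans (countContaining≡∣P∩incident∣ G P x) (cong (λ I → ∣ P ∩ I ∣) eq)

countContaining≤∣P∣ : ∀ {v} (G : Hypergraph v) P x → countContaining G P x ≤ ∣ P ∣
countContaining≤∣P∣ G P x = subst (_≤ ∣ P ∣) (sym (countContaining≡∣P∩incident∣ G P x)) (∣p∩q∣≤∣p∣ P _)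

IsPartition-∣P∣≡0⇒∣D∣≡0 : ∀ {v} (G : Hypergraph v) {D P} → IsPartition G D P → ∣ P ∣ ≡ 0 → ∣ D ∣ ≡ 0
IsPartition-∣P∣≡0⇒∣D∣≡0 G {D} {P} isPart ∣P∣≡0 = Empty⇒∣p∣≡0 D-empty
  where
  D-empty : Empty D
  D-empty (x , x∈D) with subst₂ _≤_ (isPart x x∈D) ∣P∣≡0 (countContaining≤∣P∣ G P x)
  ... | ()

NoSingleEdgePartitionAbove : ∀ {v} → Hypergraph v → ℕ → Set
NoSingleEdgePartitionAbove G m = ∀ D P → IsPartition G D P → ∣ P ∣ ≡ 1 → ∣ D ∣ ≤ m

cone : ∀ {v} (w : ℕ) → Hypergraph v → Hypergraph (w + v)
cone w G = record { e = e G ; edge = λ j → ⊤ ++ edge G j }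

_⊕_ : ∀ {va vb} → Hypergraph va → Hypergraph vb → Hypergraph (va + vb)
_⊕_ {va} {vb} GA GB = record
  { e    = e GA + e GB
  ; edge = (λ i → edge GA i ++ ⊥ {vb}) ++ᶠ (λ j → ⊥ {va} ++ edge GB j)
  }

module _ {v} (w : ℕ) (G : Hypergraph v) where

  incident-cone-↑ˡ : ∀ u → incident (cone w G) (u ↑ˡ v) ≡ ⊤
  incident-cone-↑ˡ u = tabulate≡replicate λ j → trans (lookup-++ˡ ⊤ (edge G j) u) (lookup-replicate u true)

  incident-cone-↑ʳ : ∀ x → incident (cone w G) (w ↑ʳ x) ≡ incident G x
  incident-cone-↑ʳ x = tabulate-cong λ j → lookup-++ʳ (⊤ {w}) (edge G j) x

  countContaining-cone-↑ˡ : ∀ P u → countContaining (cone w G) P (u ↑ˡ v) ≡ ∣ P ∣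
  countContaining-cone-↑ˡ P u =
    trans (countContaining-via-incident (cone w G) P (incident-cone-↑ˡ u)) (cong ∣_∣ (∩-identityʳ P))

  countContaining-cone-↑ʳ : ∀ P x → countContaining (cone w G) P (w ↑ʳ x) ≡ countContaining G P x
  countContaining-cone-↑ʳ P x =
    trans (countContaining-via-incident (cone w G) P (incident-cone-↑ʳ x)) (sym (countContaining≡∣P∩incident∣ G P x))

  cone-IsPartition : ∀ {DW D P} → IsPartition (cone w G) (DW ++ D) P → IsPartition G D P
  cone-IsPartition {DW} {D} {P} isPart x x∈D = trans (sym (countContaining-cone-↑ʳ P x)) (isPart _ (∈-++⁺ʳ DW x∈D))

  cone-noPartitionAbove : ∀ {m n} → NoPartitionAbove G n → NoSingleEdgePartitionAbove G m → w + m ≤ n →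
                          NoPartitionAbove (cone w G) n
  cone-noPartitionAbove {m} {n} bound single w+m≤n D P isPart with Vec.splitAt w D
  ... | DW , D′ , refl with nonempty? DW
  ...   | no DW-empty = begin
    ∣ DW ++ D′ ∣      ≡⟨ ∣p++q∣≡∣p∣+∣q∣ DW D′ ⟩
    ∣ DW ∣ + ∣ D′ ∣    ≡⟨ cong (_+ ∣ D′ ∣) (Empty⇒∣p∣≡0 DW-empty) ⟩
    ∣ D′ ∣            ≤⟨ bound D′ P (cone-IsPartition isPart) ⟩
    n                ∎
    where open ≤-Reasoning
  ...   | yes (u , u∈DW) = begin
    ∣ DW ++ D′ ∣      ≡⟨ ∣p++q∣≡∣p∣+∣q∣ DW D′ ⟩
    ∣ DW ∣ + ∣ D′ ∣    ≤⟨ +-mono-≤ (∣p∣≤n DW) (single D′ P (cone-IsPartition isPart) ∣P∣≡1) ⟩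
    w + m            ≤⟨ w+m≤n ⟩
    n                ∎
    where
    open ≤-Reasoning
    ∣P∣≡1 : ∣ P ∣ ≡ 1
    ∣P∣≡1 = trans (sym (countContaining-cone-↑ˡ P u)) (isPart _ (∈-++⁺ˡ D′ u∈DW))

  cone-noIsolated : Fin (e G) → NoIsolated G → NoIsolated (cone w G)
  cone-noIsolated j₀ iso = ↑ˡ-↑ʳ-elim _
    (λ u → j₀ , ∈-++⁺ˡ (edge G j₀) ∈⊤)
    (λ x → proj₁ (iso x) , ∈-++⁺ʳ ⊤ (proj₂ (iso x)))

module _ {va vb} (GA : Hypergraph va) (GB : Hypergraph vb) where

  edge-⊕-↑ˡ : ∀ i → edge (GA ⊕ GB) (i ↑ˡ e GB) ≡ edge GA i ++ ⊥
  edge-⊕-↑ˡ = Vecᶠ.lookup-++ˡ (λ i → edge GA i ++ ⊥ {vb}) (λ j → ⊥ {va} ++ edge GB j)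

  edge-⊕-↑ʳ : ∀ j → edge (GA ⊕ GB) (e GA ↑ʳ j) ≡ ⊥ ++ edge GB j
  edge-⊕-↑ʳ = Vecᶠ.lookup-++ʳ (λ i → edge GA i ++ ⊥ {vb}) (λ j → ⊥ {va} ++ edge GB j)

  incident-⊕ : ∀ x → incident (GA ⊕ GB) x ≡
    tabulate (λ i → lookup (edge GA i ++ ⊥ {vb}) x) ++ tabulate (λ j → lookup (⊥ {va} ++ edge GB j) x)
  incident-⊕ x = trans (tabulate-++ (e GA) _) (cong₂ _++_
    (tabulate-cong λ i → cong (flip lookup x) (edge-⊕-↑ˡ i))
    (tabulate-cong λ j → cong (flip lookup x) (edge-⊕-↑ʳ j)))

  incident-⊕-↑ˡ : ∀ y → incident (GA ⊕ GB) (y ↑ˡ vb) ≡ incident GA y ++ ⊥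
  incident-⊕-↑ˡ y = trans (incident-⊕ _) (cong₂ _++_
    (tabulate-cong λ i → lookup-++ˡ (edge GA i) (⊥ {vb}) y)
    (tabulate≡replicate λ j → trans (lookup-++ˡ (⊥ {va}) (edge GB j) y) (lookup-replicate y false)))

  incident-⊕-↑ʳ : ∀ y → incident (GA ⊕ GB) (va ↑ʳ y) ≡ ⊥ ++ incident GB y
  incident-⊕-↑ʳ y = trans (incident-⊕ _) (cong₂ _++_
    (tabulate≡replicate λ i → trans (lookup-++ʳ (edge GA i) (⊥ {vb}) y) (lookup-replicate y false))
    (tabulate-cong λ j → lookup-++ʳ (⊥ {va}) (edge GB j) y))

  module _ (PA : Subset (e GA)) (PB : Subset (e GB)) where
    open ≡-Reasoning

    countContaining-⊕-↑ˡ : ∀ y → countContaining (GA ⊕ GB) (PA ++ PB) (y ↑ˡ vb) ≡ countContaining GA PA y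
    countContaining-⊕-↑ˡ y = begin
      countContaining (GA ⊕ GB) (PA ++ PB) (y ↑ˡ vb)   ≡⟨ countContaining-via-incident (GA ⊕ GB) _ (incident-⊕-↑ˡ y) ⟩
      ∣ (PA ++ PB) ∩ (incident GA y ++ ⊥) ∣           ≡⟨ ∣p++q∩r++s∣≡∣p∩r∣+∣q∩s∣ PA _ PB ⊥ ⟩
      ∣ PA ∩ incident GA y ∣ + ∣ PB ∩ ⊥ ∣             ≡⟨ cong (∣ PA ∩ incident GA y ∣ +_) (∣p∩⊥∣≡0 PB) ⟩
      ∣ PA ∩ incident GA y ∣ + 0                     ≡⟨ +-identityʳ _ ⟩
      ∣ PA ∩ incident GA y ∣                         ≡⟨ countContaining≡∣P∩incident∣ GA PA y ⟨
      countContaining GA PA y                        ∎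

    countContaining-⊕-↑ʳ : ∀ y → countContaining (GA ⊕ GB) (PA ++ PB) (va ↑ʳ y) ≡ countContaining GB PB y
    countContaining-⊕-↑ʳ y = begin
      countContaining (GA ⊕ GB) (PA ++ PB) (va ↑ʳ y)   ≡⟨ countContaining-via-incident (GA ⊕ GB) _ (incident-⊕-↑ʳ y) ⟩
      ∣ (PA ++ PB) ∩ (⊥ ++ incident GB y) ∣           ≡⟨ ∣p++q∩r++s∣≡∣p∩r∣+∣q∩s∣ PA ⊥ PB _ ⟩
      ∣ PA ∩ ⊥ ∣ + ∣ PB ∩ incident GB y ∣             ≡⟨ cong (_+ ∣ PB ∩ incident GB y ∣) (∣p∩⊥∣≡0 PA) ⟩
      ∣ PB ∩ incident GB y ∣                         ≡⟨ countContaining≡∣P∩incident∣ GB PB y ⟨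
      countContaining GB PB y                        ∎

    ⊕-IsPartition : ∀ {DA DB} → IsPartition (GA ⊕ GB) (DA ++ DB) (PA ++ PB) →
                    IsPartition GA DA PA × IsPartition GB DB PB
    ⊕-IsPartition {DA} {DB} isPart =
      (λ y y∈DA → trans (sym (countContaining-⊕-↑ˡ y)) (isPart _ (∈-++⁺ˡ DB y∈DA))) ,
      (λ y y∈DB → trans (sym (countContaining-⊕-↑ʳ y)) (isPart _ (∈-++⁺ʳ DA y∈DB)))

  ⊕-noPartitionAbove : ∀ {a b} → NoPartitionAbove GA a → NoPartitionAbove GB b → NoPartitionAbove (GA ⊕ GB) (a + b)
  ⊕-noPartitionAbove {a} {b} boundA boundB D P isPart with Vec.splitAt va D | Vec.splitAt (e GA) P
  ... | DA , DB , refl | PA , PB , refl = begin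
    ∣ DA ++ DB ∣     ≡⟨ ∣p++q∣≡∣p∣+∣q∣ DA DB ⟩
    ∣ DA ∣ + ∣ DB ∣   ≤⟨ +-mono-≤ (boundA DA PA isPartA) (boundB DB PB isPartB) ⟩
    a + b           ∎
    where
    open ≤-Reasoning
    isPartA = proj₁ (⊕-IsPartition PA PB isPart)
    isPartB = proj₂ (⊕-IsPartition PA PB isPart)

  ⊕-noSingleEdgePartitionAbove : ∀ {a b} → NoPartitionAbove GA a → NoPartitionAbove GB b →
                                 NoSingleEdgePartitionAbove (GA ⊕ GB) (a ⊔ b)
  ⊕-noSingleEdgePartitionAbove {a} {b} boundA boundB D P isPart ∣P∣≡1
    with Vec.splitAt va D | Vec.splitAt (e GA) P
  ... | DA , DB , refl | PA , PB , refl = begin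
    ∣ DA ++ DB ∣     ≡⟨ ∣p++q∣≡∣p∣+∣q∣ DA DB ⟩
    ∣ DA ∣ + ∣ DB ∣   ≤⟨ one-side (m+n≡1⇒m≡0⊎n≡0 ∣ PA ∣ ∣ PB ∣ (trans (sym (∣p++q∣≡∣p∣+∣q∣ PA PB)) ∣P∣≡1)) ⟩
    a ⊔ b           ∎
    where
    open ≤-Reasoning
    isPartA = proj₁ (⊕-IsPartition PA PB isPart)
    isPartB = proj₂ (⊕-IsPartition PA PB isPart)
    one-side : ∣ PA ∣ ≡ 0 ⊎ ∣ PB ∣ ≡ 0 → ∣ DA ∣ + ∣ DB ∣ ≤ a ⊔ b
    one-side (inj₁ ∣PA∣≡0) = begin
      ∣ DA ∣ + ∣ DB ∣   ≡⟨ cong (_+ ∣ DB ∣) (IsPartition-∣P∣≡0⇒∣D∣≡0 GA isPartA ∣PA∣≡0) ⟩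
      ∣ DB ∣           ≤⟨ boundB DB PB isPartB ⟩
      b               ≤⟨ m≤n⊔m a b ⟩
      a ⊔ b           ∎
    one-side (inj₂ ∣PB∣≡0) = begin
      ∣ DA ∣ + ∣ DB ∣   ≡⟨ cong (∣ DA ∣ +_) (IsPartition-∣P∣≡0⇒∣D∣≡0 GB isPartB ∣PB∣≡0) ⟩
      ∣ DA ∣ + 0       ≡⟨ +-identityʳ _ ⟩
      ∣ DA ∣           ≤⟨ boundA DA PA isPartA ⟩
      a               ≤⟨ m≤m⊔n a b ⟩
      a ⊔ b           ∎

  ⊕-noIsolated : NoIsolated GA → NoIsolated GB → NoIsolated (GA ⊕ GB)
  ⊕-noIsolated isoA isoB = ↑ˡ-↑ʳ-elim _
    (λ y → let (i , y∈i) = isoA y in i ↑ˡ e GB , subst (y ↑ˡ vb ∈_) (sym (edge-⊕-↑ˡ i)) (∈-++⁺ˡ ⊥ y∈i))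
    (λ y → let (j , y∈j) = isoB y in e GA ↑ʳ j , subst (va ↑ʳ y ∈_) (sym (edge-⊕-↑ʳ j)) (∈-++⁺ʳ ⊥ y∈j))

HAtLeast-1 : HAtLeast 1 1
HAtLeast-1 = 1 , ≤-refl , G , (λ { Fin.zero → Fin.zero , here }) , (λ D _ _ → ∣p∣≤n D)
  where
  G : Hypergraph 1
  G = record { e = 1 ; edge = λ _ → ⊤ }

HAtLeast-+ : ∀ {a b ka kb} → a ≤ b → 1 ≤ ka → HAtLeast a ka → HAtLeast b kb → HAtLeast (a + b) (a + ka + kb)
HAtLeast-+ {a} {b} {ka} {kb} a≤b 1≤ka (va , ka≤va , GA , isoA , boundA) (vb , kb≤vb , GB , isoB , boundB) =
  a + (va + vb) ,
  ≤-trans (≤-reflexive (+-assoc a ka kb)) (+-monoʳ-≤ a (+-mono-≤ ka≤va kb≤vb)) ,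
  cone a (GA ⊕ GB) ,
  cone-noIsolated a (GA ⊕ GB) (proj₁ (isoA y₀) ↑ˡ e GB) (⊕-noIsolated GA GB isoA isoB) ,
  cone-noPartitionAbove a (GA ⊕ GB)
    (⊕-noPartitionAbove GA GB boundA boundB)
    (⊕-noSingleEdgePartitionAbove GA GB boundA boundB)
    (+-monoʳ-≤ a (≤-reflexive (m≤n⇒m⊔n≡n a≤b)))
  where
  y₀ : Fin va
  y₀ = fromℕ< (≤-trans 1≤ka ka≤va)

n/2≡⌊n/2⌋ : ∀ n → n / 2 ≡ ⌊ n /2⌋
n/2≡⌊n/2⌋ zero          = refl
n/2≡⌊n/2⌋ (suc zero)    = refl
n/2≡⌊n/2⌋ (suc (suc n)) = trans (m/n≡1+[m∸n]/n {2 + n} {2} (s≤s (s≤s z≤n))) (cong suc (n/2≡⌊n/2⌋ n))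

kFuel-unfold : ∀ f m → kFuel (suc f) (2 + m) ≡ ⌊ 2 + m /2⌋ + kFuel f ⌊ 2 + m /2⌋ + kFuel f ⌈ 2 + m /2⌉
kFuel-unfold f m rewrite n/2≡⌊n/2⌋ (2 + m) | n/2≡⌊n/2⌋ (3 + m) = refl

⌊n/2⌋≤pred : ∀ {m f} → 2 + m ≤ suc f → ⌊ 2 + m /2⌋ ≤ f
⌊n/2⌋≤pred {m} n≤f = s≤s⁻¹ (≤-trans (⌊n/2⌋<n (suc m)) n≤f)

⌈n/2⌉≤pred : ∀ {m f} → 2 + m ≤ suc f → ⌈ 2 + m /2⌉ ≤ f
⌈n/2⌉≤pred {m} n≤f = s≤s⁻¹ (≤-trans (⌈n/2⌉<n m) n≤f)

kFuel-irrelevant : ∀ {f g} n → n ≤ f → n ≤ g → kFuel f n ≡ kFuel g n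
kFuel-irrelevant {zero}  {zero}  zero _ _ = refl
kFuel-irrelevant {zero}  {suc g} zero _ _ = refl
kFuel-irrelevant {suc f} {zero}  zero _ _ = refl
kFuel-irrelevant {suc f} {suc g} zero _ _ = refl
kFuel-irrelevant {suc f} {suc g} (suc zero) _ _ = refl
kFuel-irrelevant {suc f} {suc g} (suc (suc m)) n≤f n≤g = begin
  kFuel (suc f) (2 + m)                                 ≡⟨ kFuel-unfold f m ⟩
  ⌊ 2 + m /2⌋ + kFuel f ⌊ 2 + m /2⌋ + kFuel f ⌈ 2 + m /2⌉
    ≡⟨ cong₂ (λ x y → ⌊ 2 + m /2⌋ + x + y)
         (kFuel-irrelevant _ (⌊n/2⌋≤pred n≤f) (⌊n/2⌋≤pred n≤g))
         (kFuel-irrelevant _ (⌈n/2⌉≤pred n≤f) (⌈n/2⌉≤pred n≤g)) ⟩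
  ⌊ 2 + m /2⌋ + kFuel g ⌊ 2 + m /2⌋ + kFuel g ⌈ 2 + m /2⌉ ≡⟨ kFuel-unfold g m ⟨
  kFuel (suc g) (2 + m)                                 ∎
  where open ≡-Reasoning

kSeq-unfold : ∀ m → kSeq (2 + m) ≡ ⌊ 2 + m /2⌋ + kSeq ⌊ 2 + m /2⌋ + kSeq ⌈ 2 + m /2⌉
kSeq-unfold m = trans (kFuel-unfold (suc m) m) (cong₂ (λ x y → ⌊ 2 + m /2⌋ + x + y)
  (kFuel-irrelevant _ (⌊n/2⌋≤pred {m} ≤-refl) ≤-refl)
  (kFuel-irrelevant _ (⌈n/2⌉≤pred {m} ≤-refl) ≤-refl))

kFuel-positive : ∀ f n → 1 ≤ kFuel f n
kFuel-positive zero          n             = ≤-refl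
kFuel-positive (suc f)       zero          = ≤-refl
kFuel-positive (suc f)       (suc zero)    = ≤-refl
kFuel-positive (suc f)       (suc (suc m)) = ≤-trans (kFuel-positive f _) (m≤n+m _ _)

kSeq-positive : ∀ n → 1 ≤ kSeq n
kSeq-positive n = kFuel-positive n n

halving-induction : (P : ℕ → Set) → P 1 → (∀ m → P ⌊ 2 + m /2⌋ → P ⌈ 2 + m /2⌉ → P (2 + m)) →
                    ∀ n → 1 ≤ n → P n
halving-induction P base step = <-rec (λ n → 1 ≤ n → P n) go
  where
  go : ∀ n → (∀ {k} → k < n → 1 ≤ k → P k) → 1 ≤ n → P n
  go (suc zero)    _   _ = base
  go (suc (suc m)) rec _ = step m (rec (⌊n/2⌋<n (suc m)) (s≤s z≤n)) (rec (⌈n/2⌉<n m) (s≤s z≤n))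

HAtLeast-kSeq : ∀ n → 1 ≤ n → HAtLeast n (kSeq n)
HAtLeast-kSeq = halving-induction (λ n → HAtLeast n (kSeq n)) HAtLeast-1 λ m hˡ hʳ →
  subst₂ HAtLeast (⌊n/2⌋+⌈n/2⌉≡n (2 + m)) (sym (kSeq-unfold m))
    (HAtLeast-+ (⌊n/2⌋≤⌈n/2⌉ (2 + m)) (kSeq-positive ⌊ 2 + m /2⌋) hˡ hʳ)

^-distribʳ-* : ∀ m n o → (m * n) ^ o ≡ m ^ o * n ^ o
^-distribʳ-* m n zero    = refl
^-distribʳ-* m n (suc o) = trans (cong (m * n *_) (^-distribʳ-* m n o)) (interchange m n (m ^ o) (n ^ o))
  where
  interchange : ∀ x y u v → x * y * (u * v) ≡ x * u * (y * v)
  interchange = solve-∀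

-- 2k ≥ n log₂(n + 1) − n + 1, written without logarithms.
PowerBound : ℕ → ℕ → Set
PowerBound n k = 2 * suc n ^ n ≤ 2 ^ (2 * k + n)

PowerBound-1 : PowerBound 1 1
PowerBound-1 = m≤m+n 4 4

PowerBound-+ : ∀ {a b ka kb} → a ≤ b → b ≤ suc a → PowerBound a ka → PowerBound b kb →
               PowerBound (a + b) (a + ka + kb)
PowerBound-+ {a} {b} {ka} {kb} a≤b b≤1+a boundA boundB = begin
  2 * suc (a + b) ^ (a + b)                            ≤⟨ *-monoʳ-≤ 2 (^-monoˡ-≤ (a + b) 1+a+b≤2[1+a]) ⟩
  2 * (2 * suc a) ^ (a + b)                            ≡⟨ cong (2 *_) (^-distribʳ-* 2 (suc a) (a + b)) ⟩
  2 * (2 ^ (a + b) * suc a ^ (a + b))                  ≡⟨ cong (λ x → 2 * (2 ^ (a + b) * x)) (^-distribˡ-+-* (suc a) a b) ⟩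
  2 * (2 ^ (a + b) * (suc a ^ a * suc a ^ b))          ≤⟨ *-monoʳ-≤ 2 (*-monoʳ-≤ (2 ^ (a + b))
                                                            (*-monoʳ-≤ (suc a ^ a) (^-monoˡ-≤ b (s≤s a≤b)))) ⟩
  2 * (2 ^ (a + b) * (suc a ^ a * suc b ^ b))          ≡⟨ *-assoc 2 (2 ^ (a + b)) _ ⟨
  2 ^ suc (a + b) * (suc a ^ a * suc b ^ b)            ≤⟨ *-monoˡ-≤ _ (^-monoʳ-≤ 2 1+a+b≤2[1+a]) ⟩
  2 ^ (2 * suc a) * (suc a ^ a * suc b ^ b)            ≡⟨ regroup (suc a ^ a) (suc b ^ b) ⟩
  2 ^ (a + a) * ((2 * suc a ^ a) * (2 * suc b ^ b))    ≤⟨ *-monoʳ-≤ (2 ^ (a + a)) (*-mono-≤ boundA boundB) ⟩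
  2 ^ (a + a) * (2 ^ (2 * ka + a) * 2 ^ (2 * kb + b))  ≡⟨ cong (2 ^ (a + a) *_) (^-distribˡ-+-* 2 (2 * ka + a) _) ⟨
  2 ^ (a + a) * 2 ^ ((2 * ka + a) + (2 * kb + b))      ≡⟨ ^-distribˡ-+-* 2 (a + a) _ ⟨
  2 ^ ((a + a) + ((2 * ka + a) + (2 * kb + b)))        ≡⟨ cong (2 ^_) (exponents a b ka kb) ⟩
  2 ^ (2 * (a + ka + kb) + (a + b))                    ∎
  where
  open ≤-Reasoning
  twice : ∀ a → suc a + suc a ≡ 2 * suc a
  twice = solve-∀
  double-suc : ∀ a → 2 * suc a ≡ 2 + (a + a)
  double-suc = solve-∀
  shuffle : ∀ x y z → 2 * (2 * x) * (y * z) ≡ x * ((2 * y) * (2 * z))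
  shuffle = solve-∀
  exponents : ∀ a b ka kb → (a + a) + ((2 * ka + a) + (2 * kb + b)) ≡ 2 * (a + ka + kb) + (a + b)
  exponents = solve-∀
  1+a+b≤2[1+a] : suc (a + b) ≤ 2 * suc a
  1+a+b≤2[1+a] = ≤-trans (+-monoʳ-≤ (suc a) b≤1+a) (≤-reflexive (twice a))
  regroup : ∀ y z → 2 ^ (2 * suc a) * (y * z) ≡ 2 ^ (a + a) * ((2 * y) * (2 * z))
  regroup y z = trans (cong (λ d → 2 ^ d * (y * z)) (double-suc a)) (shuffle (2 ^ (a + a)) y z)

PowerBound-kSeq : ∀ n → 1 ≤ n → PowerBound n (kSeq n)
PowerBound-kSeq = halving-induction (λ n → PowerBound n (kSeq n)) PowerBound-1 λ m hˡ hʳ →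
  subst₂ PowerBound (⌊n/2⌋+⌈n/2⌉≡n (2 + m)) (sym (kSeq-unfold m))
    (PowerBound-+ (⌊n/2⌋≤⌈n/2⌉ (2 + m)) (⌊n/2⌋-mono (n≤1+n (3 + m))) hˡ hʳ)

PowerBound⇒n^n<2^[2k+n∸1] : ∀ {n k} → 1 ≤ n → PowerBound n k → n ^ n < 2 ^ (2 * k + n ∸ 1)
PowerBound⇒n^n<2^[2k+n∸1] {suc m} {k} _ bound rewrite +-suc (2 * k) m = *-cancelˡ-< 2 _ _ (begin-strict
  2 * suc m ^ suc m        <⟨ *-monoʳ-< 2 (^-monoˡ-< (suc m) (n<1+n (suc m))) ⟩
  2 * suc (suc m) ^ suc m  ≤⟨ bound ⟩
  2 * 2 ^ (2 * k + m)      ∎)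
  where open ≤-Reasoning

mainTheorem11 : (n : ℕ) → 1 ≤ n →
    HAtLeast n (kSeq n) ×
    Σ ℕ (λ k → HAtLeast n k × (n ^ n < 2 ^ (2 * k + n ∸ 1)))
mainTheorem11 n 1≤n =
  HAtLeast-kSeq n 1≤n ,
  kSeq n , HAtLeast-kSeq n 1≤n , PowerBound⇒n^n<2^[2k+n∸1] {k = kSeq n} 1≤n (PowerBound-kSeq n 1≤n)
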